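{- Let $n \ge 5$ and $k \ge 4$ be integers, and let $B(n,k)$ be the $(n,k)$-banana tree. Then $\mathrm{rn}(B(n,k)) = n(k+6)+1$.
   Context: A $k$-star is a tree consisting of $k$ leaves and one further vertex adjacent to all of them. The $(n,k)$-banana tree $B(n,k)$ is obtained from $n$ disjoint copies of a $(k-1)$-star and one additional root vertex by joining one leaf of each copy to the root by an edge. For a connected graph $G$, a radio labeling is a map $f: V(G) \to \{0,1,2,\ldots\}$ with $d(u,v) + |f(u)-f(v)| \ge \mathrm{diam}(G)+1$ for all distinct $u,v$, where $d$ is the graph distance; its span is $\max\{|f(u)-f(v)| : u,v \in V(G)\}$, and the radio number $\mathrm{rn}(G)$ is the minimum span over all radio labelings of $G$. -}

module Defs where

open import Level using (Level; _⊔_) renaming (suc to lsuc)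
open import Data.Nat.Base using (ℕ; zero; suc; _+_; _≤_; _∸_; ∣_-_∣)
open import Data.Fin.Base using (Fin; toℕ)
open import Data.Product.Base using (_×_; ∃; ∃-syntax; _,_)
open import Data.Sum.Base using (_⊎_)
open import Relation.Binary.PropositionalEquality using (_≡_; _≢_)

module _ {a ℓ : Level} {V : Set a} (Adj : V → V → Set ℓ) where

  data Walk : V → V → ℕ → Set (a ⊔ ℓ) where
    stop : ∀ {u} → Walk u u 0
    step : ∀ {u w v m} → Adj u w → Walk w v m → Walk u v (suc m)

  IsDist : V → V → ℕ → Set (a ⊔ ℓ)
  IsDist u v d = Walk u v d × (∀ m → Walk u v m → d ≤ m)

  IsDiam : ℕ → Set (a ⊔ ℓ)
  IsDiam D = (∀ u v d → IsDist u v d → d ≤ D)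
           × ∃[ u ] ∃[ v ] IsDist u v D

  IsRadioLabeling : (V → ℕ) → Set (a ⊔ ℓ)
  IsRadioLabeling f = ∀ D → IsDiam D →
    ∀ u v → u ≢ v → ∀ d → IsDist u v d → suc D ≤ d + ∣ f u - f v ∣

  IsSpan : (V → ℕ) → ℕ → Set a
  IsSpan f s = (∀ u v → ∣ f u - f v ∣ ≤ s) × ∃[ u ] ∃[ v ] (∣ f u - f v ∣ ≡ s)

  IsRadioNumber : ℕ → Set (a ⊔ ℓ)
  IsRadioNumber r = (∃[ f ] (IsRadioLabeling f × IsSpan f r))
                  × (∀ f s → IsRadioLabeling f → IsSpan f s → r ≤ s)

-- The (n,k)-banana tree B(n,k): a root, and n disjoint copies of a
-- (k-1)-star (centre i, leaves (i , j) for j : Fin (k ∸ 1)); the leaf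
-- with index 0 of every copy is joined to the root.

data BVertex (n k : ℕ) : Set where
  root   : BVertex n k
  centre : Fin n → BVertex n k
  leaf   : Fin n → Fin (k ∸ 1) → BVertex n k

data BEdge {n k : ℕ} : BVertex n k → BVertex n k → Set where
  star-edge : ∀ i j → BEdge (centre i) (leaf i j)
  root-edge : ∀ i j → toℕ j ≡ 0 → BEdge root (leaf i j)

BAdj : ∀ {n k} → BVertex n k → BVertex n k → Set
BAdj u v = BEdge u v ⊎ BEdge v u

-- Let the height h of a vertex be its distance to the root: 1 for the leaves joined to the root,
-- 2 for the star centres and 3 for the other leaves.  Any two vertices are joined by a walk through
-- the root, so d(u,v) ≤ h u + h v, and the diameter is 6.  Listing the vertices by increasing value
-- of a radio labeling f, consecutive vertices x, y satisfy f y − f x ≥ 7 − d(x,y) ≥ 7 − h x − h y;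
-- summing over the 1 + n(k − 1) vertices, and noting that the first and the last are not both the
-- root, the span is at least 7n(k − 1) − 2n(3k − 3) + 1 = n(k + 6) + 1.  The bound is attained by
-- labeling the root, the outer leaves, the centres and the inner leaves in this order, each family
-- in steps just large enough for the radio condition.
module Submission where

open import Defs
open import Data.Bool.Base using (if_then_else_)
open import Data.Empty using (⊥-elim)
open import Data.Fin.Base using (Fin; zero; suc; toℕ; combine; fromℕ)
open import Data.Fin.Properties
  using (_≟_; toℕ<n; toℕ-combine; toℕ-injective; combine-injectiveʳ; toℕ-fromℕ)
open import Data.List.Base using (List; []; _∷_; _++_; map; length; concatMap; allFin; tabulate)
open import Data.List.Properties using (length-++; length-map; length-tabulate; map-++)
open import Data.List.Membership.Propositional using (_∈_)
open import Data.List.Membership.Propositional.Properties using (∈-map⁻; ∈-concatMap⁻)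
open import Data.List.Relation.Binary.Disjoint.Propositional using (Disjoint)
open import Data.List.Relation.Binary.Permutation.Propositional using (↭-sym; ↭⇒↭ₛ)
open import Data.List.Relation.Binary.Permutation.Propositional.Properties using (↭-length; map⁺)
import Data.List.Relation.Binary.Permutation.Setoid.Properties as Permutationₛ
open import Data.List.Relation.Unary.All as All using (All; _∷_)
import Data.List.Relation.Unary.All.Properties as AllP
open import Data.List.Relation.Unary.AllPairs as AllPairs using (AllPairs; _∷_)
import Data.List.Relation.Unary.AllPairs.Properties as AllPairsP
open import Data.List.Relation.Unary.Any using (here; there; satisfied)
open import Data.List.Relation.Unary.Linked using (Linked; _∷_)
open import Data.List.Relation.Unary.Linked.Properties using (Linked⇒All)
open import Data.List.Relation.Unary.Unique.Propositional using (Unique)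
import Data.List.Relation.Unary.Unique.Propositional.Properties as UniqueP
import Data.List.Sort as Sort
open import Data.Maybe.Base using (Maybe; just; nothing)
open import Data.Maybe.Properties using (just-injective)
open import Data.Nat.Base
open import Data.Nat.ListAction using (sum)
open import Data.Nat.ListAction.Properties using (sum-↭; sum-++)
open import Data.Nat.Properties hiding (_≟_)
open import Data.Nat.Tactic.RingSolver using (solve-∀)
open import Data.Product.Base using (∃; _,_; proj₂)
open import Data.Sum.Base using (inj₁; inj₂; swap)
open import Function.Base using (_∘_)
open import Level using (Level)
import Relation.Binary.Construct.On as On
open import Relation.Binary.PropositionalEquality
open import Relation.Nullary.Decidable using (yes; no; does)

m+n≤o⇒m≤∣n-o∣ : ∀ {m n o} → m + n ≤ o → m ≤ ∣ n - o ∣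
m+n≤o⇒m≤∣n-o∣ {m} {n} {o} m+n≤o = begin
  m          ≤⟨ m+n≤o⇒m≤o∸n m m+n≤o ⟩
  o ∸ n      ≤⟨ m∸n≤∣m-n∣ o n ⟩
  ∣ o - n ∣  ≡⟨ ∣-∣-comm o n ⟩
  ∣ n - o ∣  ∎
  where open ≤-Reasoning

m≢n⇒0<∣m-n∣ : ∀ {m n} → m ≢ n → 0 < ∣ m - n ∣
m≢n⇒0<∣m-n∣ m≢n = n≢0⇒n>0 (m≢n ∘ ∣m-n∣≡0⇒m≡n)

m≢n⇒o≤∣p+o*m-p+o*n∣ : ∀ p o {m n} → m ≢ n → o ≤ ∣ p + o * m - (p + o * n) ∣
m≢n⇒o≤∣p+o*m-p+o*n∣ p o {m} {n} m≢n = begin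
  o                               ≡⟨ *-identityʳ o ⟨
  o * 1                           ≤⟨ *-monoʳ-≤ o (m≢n⇒0<∣m-n∣ m≢n) ⟩
  o * ∣ m - n ∣                   ≡⟨ *-distribˡ-∣-∣ o m n ⟩
  ∣ o * m - o * n ∣               ≡⟨ ∣m+n-m+o∣≡∣n-o∣ p (o * m) (o * n) ⟨
  ∣ p + o * m - (p + o * n) ∣     ∎
  where open ≤-Reasoning

m∸n+o≤p⇒m≤n+∣o-p∣ : ∀ {m} n {o p} → m ∸ n + o ≤ p → m ≤ n + ∣ o - p ∣
m∸n+o≤p⇒m≤n+∣o-p∣ {m} n gap = ≤-trans (m≤n+m∸n m n) (+-monoʳ-≤ n (m+n≤o⇒m≤∣n-o∣ gap))

length-allFin : ∀ m → length (allFin m) ≡ m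
length-allFin m = length-tabulate (λ i → i)

final : ∀ {a} {A : Set a} → A → List A → A
final x []       = x
final _ (y ∷ ys) = final y ys

final-∈ : ∀ {a} {A : Set a} (x : A) xs → final x xs ∈ x ∷ xs
final-∈ x []       = here refl
final-∈ x (y ∷ ys) = there (final-∈ y ys)

module _ {a ℓ : Level} {V : Set a} {Adj : V → V → Set ℓ} where

  _++ʷ_ : ∀ {u w v p q} → Walk Adj u w p → Walk Adj w v q → Walk Adj u v (p + q)
  stop     ++ʷ q = q
  step e p ++ʷ q = step e (p ++ʷ q)

  reverseʷ : (∀ {u v} → Adj u v → Adj v u) → ∀ {u v m} → Walk Adj u v m → Walk Adj v u m
  reverseʷ sym-Adj stop = stop
  reverseʷ sym-Adj {m = suc m} (step e p) =
    subst (Walk Adj _ _) (+-comm m 1) (reverseʷ sym-Adj p ++ʷ step (sym-Adj e) stop)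

  module _ (δ : V → V → ℕ) (δ-refl : ∀ u → δ u u ≡ 0)
           (δ-edge : ∀ {u w} → Adj u w → ∀ v → δ u v ≤ suc (δ w v)) where

    δ≤length : ∀ {u v m} → Walk Adj u v m → δ u v ≤ m
    δ≤length {u} stop = ≤-reflexive (δ-refl u)
    δ≤length {v = v} (step e p) = ≤-trans (δ-edge e v) (s≤s (δ≤length p))

    isDist-δ : (∀ u v → Walk Adj u v (δ u v)) → ∀ u v → IsDist Adj u v (δ u v)
    isDist-δ walk u v = walk u v , λ _ → δ≤length

module RadioLowerBound
  {a ℓ : Level} {V : Set a} {Adj : V → V → Set ℓ}
  {D : ℕ} (diameter : IsDiam Adj D)
  (distance : ∀ u v → ∃ (IsDist Adj u v))
  (h : V → ℕ) (via : ∀ u v → Walk Adj u v (h u + h v))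
  (h-positive : ∀ u v → u ≢ v → 1 ≤ h u + h v)
  {f : V → ℕ} (radio : IsRadioLabeling Adj f) where

  open ≤-Reasoning

  Ascending : List V → Set a
  Ascending = Linked (λ x y → f x ≤ f y)

  consecutive-gap : ∀ {x y} → x ≢ y → f x ≤ f y → f x + suc D ≤ f y + (h x + h y)
  consecutive-gap {x} {y} x≢y fx≤fy with distance x y
  ... | d , d-isDist = begin
    f x + suc D                  ≤⟨ +-monoʳ-≤ (f x) (radio D diameter x y x≢y d d-isDist) ⟩
    f x + (d + ∣ f x - f y ∣)    ≡⟨ cong (λ e → f x + (d + e)) (m≤n⇒∣m-n∣≡n∸m fx≤fy) ⟩
    f x + (d + (f y ∸ f x))      ≡⟨ exchange (f x) d (f y ∸ f x) ⟩
    d + (f x + (f y ∸ f x))      ≡⟨ cong (d +_) (m+[n∸m]≡n fx≤fy) ⟩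
    d + f y                      ≤⟨ +-monoˡ-≤ (f y) (proj₂ d-isDist _ (via x y)) ⟩
    h x + h y + f y              ≡⟨ +-comm (h x + h y) (f y) ⟩
    f y + (h x + h y)            ∎
    where
      exchange : ∀ a b c → a + (b + c) ≡ b + (a + c)
      exchange = solve-∀

  telescope : ∀ x xs → Ascending (x ∷ xs) → Unique (x ∷ xs) →
              f x + suc D * length xs + h x + h (final x xs)
                ≤ f (final x xs) + 2 * sum (map h (x ∷ xs))
  telescope x [] _ _ = ≤-reflexive (double (f x) (suc D) (h x))
    where
      double : ∀ a d b → a + d * 0 + b + b ≡ a + 2 * (b + 0)
      double = solve-∀
  telescope x (y ∷ ys) (fx≤fy ∷ asc) ((x≢y ∷ _) ∷ unique) = begin
    f x + suc D * suc (length ys) + h x + h z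
      ≡⟨ split (f x) (suc D) (length ys) (h x) (h z) ⟩
    (f x + suc D) + (suc D * length ys + h x + h z)
      ≤⟨ +-monoˡ-≤ _ (consecutive-gap x≢y fx≤fy) ⟩
    f y + (h x + h y) + (suc D * length ys + h x + h z)
      ≡⟨ regroup (f y) (h x) (h y) (suc D * length ys) (h z) ⟩
    f y + suc D * length ys + h y + h z + 2 * h x
      ≤⟨ +-monoˡ-≤ (2 * h x) (telescope y ys asc unique) ⟩
    f z + 2 * sum (map h (y ∷ ys)) + 2 * h x
      ≡⟨ merge (f z) (sum (map h (y ∷ ys))) (h x) ⟩
    f z + 2 * sum (map h (x ∷ y ∷ ys))
      ∎
    where
      z = final y ys
      split : ∀ a d m b c → a + d * suc m + b + c ≡ (a + d) + (d * m + b + c)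
      split = solve-∀
      regroup : ∀ a b c m e → a + (b + c) + (m + b + e) ≡ a + m + c + e + 2 * b
      regroup = solve-∀
      merge : ∀ a s b → a + 2 * s + 2 * b ≡ a + 2 * (b + s)
      merge = solve-∀

  ascending-span-bound : ∀ {s} → IsSpan Adj f s → ∀ x y zs →
    Ascending (x ∷ y ∷ zs) → Unique (x ∷ y ∷ zs) →
    suc D * length (y ∷ zs) + 1 ≤ s + 2 * sum (map h (x ∷ y ∷ zs))
  ascending-span-bound {s} (spanned , _) x y zs asc@(fx≤fy ∷ asc′) unique@(x∉ ∷ _) =
    +-cancelˡ-≤ (f x) _ _ (begin
      f x + (L + 1)                        ≡⟨ +-assoc (f x) L 1 ⟨
      f x + L + 1                          ≤⟨ +-monoʳ-≤ (f x + L) (h-positive x z x≢z) ⟩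
      f x + L + (h x + h z)                ≡⟨ +-assoc (f x + L) (h x) (h z) ⟨
      f x + L + h x + h z                  ≤⟨ telescope x (y ∷ zs) asc unique ⟩
      f z + Σ                              ≤⟨ +-monoˡ-≤ Σ fz≤fx+s ⟩
      f x + s + Σ                          ≡⟨ +-assoc (f x) s Σ ⟩
      f x + (s + Σ)                        ∎)
    where
      z = final y zs
      L = suc D * length (y ∷ zs)
      Σ = 2 * sum (map h (x ∷ y ∷ zs))
      x≢z : x ≢ z
      x≢z = All.lookup x∉ (final-∈ y zs)
      fx≤fz : f x ≤ f z
      fx≤fz = All.lookup (Linked⇒All ≤-trans fx≤fy asc′) (final-∈ y zs)
      fz≤fx+s : f z ≤ f x + s
      fz≤fx+s = begin
        f z                     ≡⟨ m+[n∸m]≡n fx≤fz ⟨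
        f x + (f z ∸ f x)       ≡⟨ cong (f x +_) (m≤n⇒∣m-n∣≡n∸m fx≤fz) ⟨
        f x + ∣ f x - f z ∣     ≤⟨ +-monoʳ-≤ (f x) (spanned x z) ⟩
        f x + s                 ∎

  span-lower-bound : ∀ {s} → IsSpan Adj f s → ∀ vs → Unique vs → 2 ≤ length vs →
    suc D * (length vs ∸ 1) + 1 ≤ s + 2 * sum (map h vs)
  span-lower-bound {s} span vs unique 2≤|vs| =
    subst₂ (λ l σ → suc D * (l ∸ 1) + 1 ≤ s + 2 * σ)
      (↭-length sorted↭vs) (sum-↭ (map⁺ h sorted↭vs))
      (bound (sort vs) (sort-↗ vs)
        (Permutationₛ.Unique-resp-↭ (setoid V) (↭⇒↭ₛ (↭-sym sorted↭vs)) unique)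
        (subst (2 ≤_) (sym (↭-length sorted↭vs)) 2≤|vs|))
    where
      open Sort (On.decTotalOrder ≤-decTotalOrder f)
      sorted↭vs = sort-↭ vs
      bound : ∀ ws → Ascending ws → Unique ws → 2 ≤ length ws →
              suc D * (length ws ∸ 1) + 1 ≤ s + 2 * sum (map h ws)
      bound (x ∷ y ∷ zs) asc unique _ = ascending-span-bound span x y zs asc unique
      bound (_ ∷ []) _ _ (s≤s ())

-- B(n, 2 + c): each star has one inner leaf (index zero, adjacent to the root) and c outer leaves.
module _ {n c : ℕ} where

  private
    Vertex = BVertex n (2 + c)
    Adj    = BAdj {n} {2 + c}

  height : Vertex → ℕ
  height root             = 0
  height (centre i)       = 2
  height (leaf i zero)    = 1
  height (leaf i (suc t)) = 3

  leaf-height≥1 : ∀ i a → 1 ≤ height (leaf i a)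
  leaf-height≥1 i zero    = s≤s z≤n
  leaf-height≥1 i (suc t) = s≤s z≤n

  height≤3 : ∀ v → height v ≤ 3
  height≤3 root             = z≤n
  height≤3 (centre i)       = s≤s (s≤s z≤n)
  height≤3 (leaf i zero)    = s≤s z≤n
  height≤3 (leaf i (suc t)) = ≤-refl

  height-positive : ∀ u v → u ≢ v → 1 ≤ height u + height v
  height-positive root root       r≢r = ⊥-elim (r≢r refl)
  height-positive root (centre i) _   = s≤s z≤n
  height-positive root (leaf i a) _   = leaf-height≥1 i a
  height-positive (centre i) v    _   = s≤s z≤n
  height-positive (leaf i a) v    _   = ≤-trans (leaf-height≥1 i a) (m≤m+n _ _)

  centre-to-root : ∀ i → Walk Adj (centre i) root 2
  centre-to-root i = step (inj₁ (star-edge i zero)) (step (inj₂ (root-edge i zero refl)) stop)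

  to-root : ∀ u → Walk Adj u root (height u)
  to-root root             = stop
  to-root (centre i)       = centre-to-root i
  to-root (leaf i zero)    = step (inj₂ (root-edge i zero refl)) stop
  to-root (leaf i (suc t)) = step (inj₂ (star-edge i (suc t))) (centre-to-root i)

  via-root : ∀ u v → Walk Adj u v (height u + height v)
  via-root u v = to-root u ++ʷ reverseʷ swap (to-root v)

  distance : Vertex → Vertex → ℕ
  distance (centre i) (centre j) = if does (i ≟ j) then 0 else 4
  distance (centre i) (leaf j b) = if does (i ≟ j) then 1 else 2 + height (leaf j b)
  distance (leaf i a) (centre j) = if does (i ≟ j) then 1 else height (leaf i a) + 2
  distance (leaf i a) (leaf j b) =
    if does (i ≟ j) then (if does (a ≟ b) then 0 else 2) else height (leaf i a) + height (leaf j b)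
  distance u v = height u + height v

  distance-refl : ∀ u → distance u u ≡ 0
  distance-refl root = refl
  distance-refl (centre i) with i ≟ i
  ... | yes _  = refl
  ... | no i≢i = ⊥-elim (i≢i refl)
  distance-refl (leaf i a) with i ≟ i | a ≟ a
  ... | yes _  | yes _  = refl
  ... | yes _  | no a≢a = ⊥-elim (a≢a refl)
  ... | no i≢i | _      = ⊥-elim (i≢i refl)

  distance-centre→leaf : ∀ i a v → distance (centre i) v ≤ suc (distance (leaf i a) v)
  distance-centre→leaf i a root = s≤s (≤-trans (leaf-height≥1 i a) (m≤m+n _ 0))
  distance-centre→leaf i a (centre j) with i ≟ j
  ... | yes _ = z≤n
  ... | no _  = s≤s (+-monoˡ-≤ 2 (leaf-height≥1 i a))
  distance-centre→leaf i a (leaf j b) with i ≟ j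
  ... | yes _ = s≤s z≤n
  ... | no _  = s≤s (+-monoˡ-≤ (height (leaf j b)) (leaf-height≥1 i a))

  distance-leaf→centre : ∀ i a v → distance (leaf i a) v ≤ suc (distance (centre i) v)
  distance-leaf→centre i a root = ≤-trans (≤-reflexive (+-identityʳ _)) (height≤3 (leaf i a))
  distance-leaf→centre i a (centre j) with i ≟ j
  ... | yes _ = ≤-refl
  ... | no _  = +-monoˡ-≤ 2 (height≤3 (leaf i a))
  distance-leaf→centre i a (leaf j b) with i ≟ j | a ≟ b
  ... | yes _ | yes _ = z≤n
  ... | yes _ | no _  = ≤-refl
  ... | no _  | _     = +-monoˡ-≤ (height (leaf j b)) (height≤3 (leaf i a))

  distance-root→leaf : ∀ i v → distance root v ≤ suc (distance (leaf i zero) v)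
  distance-root→leaf i root = z≤n
  distance-root→leaf i (centre j) with i ≟ j
  ... | yes _ = ≤-refl
  ... | no _  = s≤s (s≤s z≤n)
  distance-root→leaf i (leaf j b) with i ≟ j
  distance-root→leaf i (leaf j zero)    | yes _ = ≤-refl
  distance-root→leaf i (leaf j (suc t)) | yes _ = ≤-refl
  distance-root→leaf i (leaf j b)       | no _  = m≤n+m _ 2

  distance-leaf→root : ∀ i v → distance (leaf i zero) v ≤ suc (distance root v)
  distance-leaf→root i root = ≤-refl
  distance-leaf→root i (centre j) with i ≟ j
  ... | yes _ = s≤s z≤n
  ... | no _  = ≤-refl
  distance-leaf→root i (leaf j b) with i ≟ j
  distance-leaf→root i (leaf j zero)    | yes _ = z≤n
  distance-leaf→root i (leaf j (suc t)) | yes _ = s≤s (s≤s z≤n)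
  distance-leaf→root i (leaf j b)       | no _  = ≤-refl

  distance-edge : ∀ {u w} → Adj u w → ∀ v → distance u v ≤ suc (distance w v)
  distance-edge (inj₁ (star-edge i a))        = distance-centre→leaf i a
  distance-edge (inj₂ (star-edge i a))        = distance-leaf→centre i a
  distance-edge (inj₁ (root-edge i zero _))   = distance-root→leaf i
  distance-edge (inj₂ (root-edge i zero _))   = distance-leaf→root i

  distance-walk : ∀ u v → Walk Adj u v (distance u v)
  distance-walk (centre i) (centre j) with i ≟ j
  ... | yes refl = stop
  ... | no _     = via-root (centre i) (centre j)
  distance-walk (centre i) (leaf j b) with i ≟ j
  ... | yes refl = step (inj₁ (star-edge i b)) stop
  ... | no _     = via-root (centre i) (leaf j b)
  distance-walk (leaf i a) (centre j) with i ≟ j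
  ... | yes refl = step (inj₂ (star-edge i a)) stop
  ... | no _     = via-root (leaf i a) (centre j)
  distance-walk (leaf i a) (leaf j b) with i ≟ j
  ... | no _ = via-root (leaf i a) (leaf j b)
  ... | yes refl with a ≟ b
  ...   | yes refl = stop
  ...   | no _     = step (inj₂ (star-edge i a)) (step (inj₁ (star-edge i b)) stop)
  distance-walk root       v    = via-root root v
  distance-walk (centre i) root = via-root (centre i) root
  distance-walk (leaf i a) root = via-root (leaf i a) root

  distance≤length : ∀ {u v m} → Walk Adj u v m → distance u v ≤ m
  distance≤length = δ≤length distance distance-refl distance-edge

  isDistance : ∀ u v → IsDist Adj u v (distance u v)
  isDistance = isDist-δ distance distance-refl distance-edge distance-walk

  distance-sym : ∀ u v → distance u v ≡ distance v u
  distance-sym u v = ≤-antisym (distance≤length (reverseʷ swap (distance-walk v u)))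
                               (distance≤length (reverseʷ swap (distance-walk u v)))

  dist≤height+height : ∀ {u v d} → IsDist Adj u v d → d ≤ height u + height v
  dist≤height+height {u} {v} (_ , minimal) = minimal _ (via-root u v)

  dist≤6 : ∀ {u v d} → IsDist Adj u v d → d ≤ 6
  dist≤6 {u} {v} isDist = ≤-trans (dist≤height+height isDist) (+-mono-≤ (height≤3 u) (height≤3 v))

  diameter≤6 : ∀ {D} → IsDiam Adj D → D ≤ 6
  diameter≤6 (_ , _ , _ , isDist) = dist≤6 isDist

  -- Counting the vertices and their heights

  leaves : Fin n → List Vertex
  leaves i = map (leaf i) (allFin (suc c))

  star : Fin n → List Vertex
  star i = centre i ∷ leaves i

  vertices : List Vertex
  vertices = root ∷ concatMap star (allFin n)

  star-of : Vertex → Maybe (Fin n)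
  star-of root       = nothing
  star-of (centre i) = just i
  star-of (leaf i _) = just i

  ∈-star⇒star-of : ∀ {i v} → v ∈ star i → star-of v ≡ just i
  ∈-star⇒star-of (here refl) = refl
  ∈-star⇒star-of {i} (there v∈) with ∈-map⁻ (leaf i) v∈
  ... | _ , _ , refl = refl

  star-unique : ∀ i → Unique (star i)
  star-unique i = All.tabulate centre∉leaves ∷ UniqueP.map⁺ leaf-injective (UniqueP.allFin⁺ (suc c))
    where
      centre∉leaves : ∀ {v} → v ∈ leaves i → centre i ≢ v
      centre∉leaves v∈ refl with ∈-map⁻ (leaf i) v∈
      ... | _ , _ , ()
      leaf-injective : ∀ {a b} → leaf {n} {2 + c} i a ≡ leaf i b → a ≡ b
      leaf-injective refl = refl

  stars-disjoint : AllPairs Disjoint (map star (allFin n))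
  stars-disjoint = AllPairsP.map⁺ (AllPairs.map disjoint (UniqueP.allFin⁺ n))
    where
      disjoint : ∀ {i j} → i ≢ j → Disjoint (star i) (star j)
      disjoint i≢j (v∈i , v∈j) =
        i≢j (just-injective (trans (sym (∈-star⇒star-of v∈i)) (∈-star⇒star-of v∈j)))

  root∉stars : ∀ {v} → v ∈ concatMap star (allFin n) → root ≢ v
  root∉stars v∈ refl with satisfied (∈-concatMap⁻ star {xs = allFin n} v∈)
  ... | _ , root∈ with ∈-star⇒star-of root∈
  ... | ()

  vertices-unique : Unique vertices
  vertices-unique = All.tabulate root∉stars
                  ∷ UniqueP.concat⁺ (AllP.map⁺ (All.universal star-unique _)) stars-disjoint

  length-leaves : ∀ i → length (leaves i) ≡ suc c
  length-leaves i = trans (length-map (leaf {n} {2 + c} i) (allFin (suc c))) (length-allFin (suc c))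

  length-stars : ∀ is → length (concatMap star is) ≡ length is * (2 + c)
  length-stars []       = refl
  length-stars (i ∷ is) =
    trans (length-++ (star i)) (cong₂ _+_ (cong suc (length-leaves i)) (length-stars is))

  length-vertices : length vertices ≡ suc (n * (2 + c))
  length-vertices = cong suc (trans (length-stars (allFin n)) (cong (_* (2 + c)) (length-allFin n)))

  sum-heights-leaves : ∀ i → sum (map height (leaves i)) ≡ 1 + c * 3
  sum-heights-leaves i = cong (1 +_) (outer (λ t → t))
    where
      outer : ∀ {m} (g : Fin m → Fin c) →
              sum (map height (map (leaf {n} {2 + c} i) (tabulate (λ t → suc (g t))))) ≡ m * 3
      outer {zero}  g = refl
      outer {suc m} g = cong (3 +_) (outer (λ t → g (suc t)))

  sum-heights-stars : ∀ is → sum (map height (concatMap star is)) ≡ length is * (3 + c * 3)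
  sum-heights-stars []       = refl
  sum-heights-stars (i ∷ is) = begin
    sum (map height (star i ++ concatMap star is))
      ≡⟨ cong sum (map-++ height (star i) _) ⟩
    sum (map height (star i) ++ map height (concatMap star is))
      ≡⟨ sum-++ (map height (star i)) _ ⟩
    sum (map height (star i)) + sum (map height (concatMap star is))
      ≡⟨ cong₂ _+_ (cong (2 +_) (sum-heights-leaves i)) (sum-heights-stars is) ⟩
    (3 + c * 3) + length is * (3 + c * 3)
      ∎
    where open ≡-Reasoning

  sum-heights-vertices : sum (map height vertices) ≡ n * (3 + c * 3)
  sum-heights-vertices = trans (sum-heights-stars (allFin n)) (cong (_* (3 + c * 3)) (length-allFin n))

  radio-span≥ : ∀ {f s} → 1 ≤ n → IsDiam Adj 6 → IsRadioLabeling Adj f → IsSpan Adj f s →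
    n * (2 + c + 6) + 1 ≤ s
  radio-span≥ {f} {s} 1≤n diameter radio span = +-cancelʳ-≤ (2 * (n * (3 + c * 3))) _ _ (begin
    n * (2 + c + 6) + 1 + 2 * (n * (3 + c * 3))   ≡⟨ count n c ⟩
    7 * (n * (2 + c)) + 1                          ≡⟨ cong (λ l → 7 * (l ∸ 1) + 1) length-vertices ⟨
    7 * (length vertices ∸ 1) + 1
      ≤⟨ RadioLowerBound.span-lower-bound diameter (λ u v → _ , isDistance u v) height via-root
           height-positive {f = f} radio span vertices vertices-unique 2≤|vertices| ⟩
    s + 2 * sum (map height vertices)              ≡⟨ cong (λ σ → s + 2 * σ) sum-heights-vertices ⟩
    s + 2 * (n * (3 + c * 3))                      ∎)
    where
      open ≤-Reasoning
      count : ∀ n c → n * (2 + c + 6) + 1 + 2 * (n * (3 + c * 3)) ≡ 7 * (n * (2 + c)) + 1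
      count = solve-∀
      2≤|vertices| : 2 ≤ length vertices
      2≤|vertices| = subst (2 ≤_) (sym length-vertices) (s≤s (≤-trans 1≤n (m≤m*n n (2 + c))))

  -- An optimal radio labeling: in increasing order the root, the outer leaves (by leaf index,
  -- then by star), the centres and the inner leaves.
  label : Vertex → ℕ
  label root             = 0
  label (leaf i (suc t)) = 4 + toℕ (combine t i)
  label (centre i)       = 5 + c * n + 3 * toℕ i
  label (leaf i zero)    = 6 + c * n + 3 * n + 5 * toℕ i

  open ≤-Reasoning

  outer-label< : ∀ i t → label (leaf i (suc t)) < 4 + c * n
  outer-label< i t = +-monoʳ-≤ 4 (toℕ<n (combine t i))

  centre-label< : ∀ i → 3 + label (centre i) ≤ 5 + c * n + 3 * n
  centre-label< i = begin
    3 + (5 + c * n + 3 * toℕ i)   ≡⟨ shift (c * n) (toℕ i) ⟩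
    5 + c * n + 3 * suc (toℕ i)   ≤⟨ +-monoʳ-≤ (5 + c * n) (*-monoʳ-≤ 3 (toℕ<n i)) ⟩
    5 + c * n + 3 * n             ∎
    where
      shift : ∀ a x → 3 + (5 + a + 3 * x) ≡ 5 + a + 3 * suc x
      shift = solve-∀

  outer+6≤centre : 5 ≤ n → ∀ i t → 6 + label (leaf i (suc t)) ≤ label (centre i)
  outer+6≤centre 5≤n i t = begin
    10 + toℕ (combine t i)          ≡⟨ cong (10 +_) (toℕ-combine t i) ⟩
    10 + (n * toℕ t + toℕ i)        ≡⟨ regroup (n * toℕ t) (toℕ i) ⟩
    5 + (5 + n * toℕ t) + toℕ i     ≤⟨ +-monoˡ-≤ (toℕ i) (+-monoʳ-≤ 5 (+-monoˡ-≤ (n * toℕ t) 5≤n)) ⟩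
    5 + (n + n * toℕ t) + toℕ i     ≡⟨ cong (λ x → 5 + x + toℕ i) (*-suc n (toℕ t)) ⟨
    5 + n * suc (toℕ t) + toℕ i     ≤⟨ +-monoˡ-≤ (toℕ i) (+-monoʳ-≤ 5 (*-monoʳ-≤ n (toℕ<n t))) ⟩
    5 + n * c + toℕ i               ≤⟨ +-monoʳ-≤ (5 + n * c) (m≤m+n (toℕ i) (2 * toℕ i)) ⟩
    5 + n * c + 3 * toℕ i           ≡⟨ cong (λ x → 5 + x + 3 * toℕ i) (*-comm n c) ⟩
    5 + c * n + 3 * toℕ i           ∎
    where
      regroup : ∀ a x → 10 + (a + x) ≡ 5 + (5 + a) + x
      regroup = solve-∀

  outer+5≤inner : 5 ≤ n → ∀ i t j → 5 + label (leaf i (suc t)) ≤ label (leaf j zero)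
  outer+5≤inner 5≤n i t j = begin
    5 + label (leaf i (suc t))      ≤⟨ +-monoʳ-≤ 4 (outer-label< i t) ⟩
    6 + (2 + c * n)                 ≤⟨ +-monoʳ-≤ 6 (+-monoˡ-≤ (c * n) 2≤3n) ⟩
    6 + (3 * n + c * n)             ≡⟨ cong (6 +_) (+-comm (3 * n) (c * n)) ⟩
    6 + c * n + 3 * n               ≤⟨ m≤m+n _ (5 * toℕ j) ⟩
    label (leaf j zero)             ∎
    where
      2≤3n : 2 ≤ 3 * n
      2≤3n = ≤-trans (m≤m+n 2 3) (≤-trans 5≤n (m≤m+n n (2 * n)))

  centre+6≤inner : 5 ≤ n → ∀ i → 6 + label (centre i) ≤ label (leaf i zero)
  centre+6≤inner 5≤n i = begin
    6 + (5 + c * n + 3 * toℕ i)       ≡⟨ regroup (c * n) (toℕ i) ⟩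
    6 + c * n + (5 + 3 * toℕ i)       ≤⟨ +-monoʳ-≤ (6 + c * n) (+-mono-≤ 5≤3n (*-monoˡ-≤ (toℕ i) 3≤5)) ⟩
    6 + c * n + (3 * n + 5 * toℕ i)   ≡⟨ +-assoc (6 + c * n) (3 * n) (5 * toℕ i) ⟨
    label (leaf i zero)               ∎
    where
      regroup : ∀ a x → 6 + (5 + a + 3 * x) ≡ 6 + a + (5 + 3 * x)
      regroup = solve-∀
      5≤3n : 5 ≤ 3 * n
      5≤3n = ≤-trans 5≤n (m≤m+n n (2 * n))
      3≤5 : 3 ≤ 5
      3≤5 = m≤m+n 3 2

  centre+4≤inner : ∀ i j → 4 + label (centre i) ≤ label (leaf j zero)
  centre+4≤inner i j = ≤-trans (s≤s (centre-label< i)) (m≤m+n _ (5 * toℕ j))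

  inner-label-split : ∀ i → label (leaf i zero) ≡ 1 + (c * n + 3 * n) + 5 * suc (toℕ i)
  inner-label-split i = regroup (c * n) (3 * n) (toℕ i)
    where
      regroup : ∀ a b x → 6 + a + b + 5 * x ≡ 1 + (a + b) + 5 * suc x
      regroup = solve-∀

  max-label-split : 1 + (c * n + 3 * n) + 5 * n ≡ n * (2 + c + 6) + 1
  max-label-split = regroup c n
    where
      regroup : ∀ c n → 1 + (c * n + 3 * n) + 5 * n ≡ n * (2 + c + 6) + 1
      regroup = solve-∀

  inner-label≤max : ∀ i → label (leaf i zero) ≤ n * (2 + c + 6) + 1
  inner-label≤max i = begin
    label (leaf i zero)                       ≡⟨ inner-label-split i ⟩
    1 + (c * n + 3 * n) + 5 * suc (toℕ i)     ≤⟨ +-monoʳ-≤ (1 + (c * n + 3 * n)) (*-monoʳ-≤ 5 (toℕ<n i)) ⟩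
    1 + (c * n + 3 * n) + 5 * n               ≡⟨ max-label-split ⟩
    n * (2 + c + 6) + 1                       ∎

  label≤max : 5 ≤ n → ∀ v → label v ≤ n * (2 + c + 6) + 1
  label≤max 5≤n root             = z≤n
  label≤max 5≤n (centre i)       =
    ≤-trans (m≤n+m _ 6) (≤-trans (centre+6≤inner 5≤n i) (inner-label≤max i))
  label≤max 5≤n (leaf i zero)    = inner-label≤max i
  label≤max 5≤n (leaf i (suc t)) =
    ≤-trans (m≤n+m _ 5) (≤-trans (outer+5≤inner 5≤n i t i) (inner-label≤max i))

  label-span : 5 ≤ n → (top : Fin n) → suc (toℕ top) ≡ n → IsSpan Adj label (n * (2 + c + 6) + 1)
  label-span 5≤n top top-is-last =
      (λ u v → ≤-trans (∣m-n∣≤m⊔n (label u) (label v)) (⊔-lub (label≤max 5≤n u) (label≤max 5≤n v)))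
    , root , leaf top zero
    , trans (inner-label-split top)
        (trans (cong (λ m → 1 + (c * n + 3 * n) + 5 * m) top-is-last) max-label-split)

  Separated : Vertex → Vertex → Set
  Separated u v = 7 ≤ distance u v + ∣ label u - label v ∣

  separated-sym : ∀ u v → Separated u v → Separated v u
  separated-sym u v = subst₂ (λ d e → 7 ≤ d + e) (distance-sym u v) (∣-∣-comm (label u) (label v))

  separated-root : ∀ v → root ≢ v → Separated root v
  separated-root root             r≢r = ⊥-elim (r≢r refl)
  separated-root (centre i)       _   = m∸n+o≤p⇒m≤n+∣o-p∣ 2 (m≤m+n 5 _)
  separated-root (leaf i zero)    _   = m∸n+o≤p⇒m≤n+∣o-p∣ 1 (m≤m+n 6 _)
  separated-root (leaf i (suc t)) _   = m∸n+o≤p⇒m≤n+∣o-p∣ 3 (m≤m+n 4 _)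

  separated-centres : ∀ {i j} → i ≢ j → Separated (centre i) (centre j)
  separated-centres {i} {j} i≢j with i ≟ j
  ... | yes i≡j = ⊥-elim (i≢j i≡j)
  ... | no _    = +-monoʳ-≤ 4 (m≢n⇒o≤∣p+o*m-p+o*n∣ (5 + c * n) 3 (i≢j ∘ toℕ-injective))

  separated-inner : ∀ {i j} → i ≢ j → Separated (leaf i zero) (leaf j zero)
  separated-inner {i} {j} i≢j with i ≟ j
  ... | yes i≡j = ⊥-elim (i≢j i≡j)
  ... | no _    = +-monoʳ-≤ 2 (m≢n⇒o≤∣p+o*m-p+o*n∣ (6 + c * n + 3 * n) 5 (i≢j ∘ toℕ-injective))

  outer-same-star-gap : ∀ i s t → s ≢ t → n ≤ ∣ label (leaf i (suc s)) - label (leaf i (suc t)) ∣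
  outer-same-star-gap i s t s≢t = begin
    n                                               ≤⟨ m≢n⇒o≤∣p+o*m-p+o*n∣ (toℕ i) n (s≢t ∘ toℕ-injective) ⟩
    ∣ toℕ i + n * toℕ s - (toℕ i + n * toℕ t) ∣     ≡⟨ cong₂ ∣_-_∣ (position s) (position t) ⟩
    ∣ toℕ (combine s i) - toℕ (combine t i) ∣       ≡⟨ ∣m+n-m+o∣≡∣n-o∣ 4 (toℕ (combine s i)) (toℕ (combine t i)) ⟨
    ∣ label (leaf i (suc s)) - label (leaf i (suc t)) ∣ ∎
    where
      position : ∀ t → toℕ i + n * toℕ t ≡ toℕ (combine t i)
      position t = trans (+-comm (toℕ i) (n * toℕ t)) (sym (toℕ-combine t i))

  outer-labels-injective : ∀ {i j s t} → label (leaf i (suc s)) ≡ label (leaf j (suc t)) → i ≡ j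
  outer-labels-injective {i} {j} {s} {t} eq =
    combine-injectiveʳ s i t j (toℕ-injective (+-cancelˡ-≡ 4 _ _ eq))

  separated-outer : 5 ≤ n → ∀ i j s t → (i ≡ j → s ≢ t) →
                    Separated (leaf i (suc s)) (leaf j (suc t))
  separated-outer 5≤n i j s t distinct with i ≟ j
  ... | no i≢j = +-monoʳ-≤ 6 (m≢n⇒0<∣m-n∣ (i≢j ∘ outer-labels-injective))
  ... | yes refl with s ≟ t
  ...   | yes s≡t = ⊥-elim (distinct refl s≡t)
  ...   | no s≢t  = +-monoʳ-≤ 2 (≤-trans 5≤n (outer-same-star-gap i s t s≢t))

  separated-outer-centre : 5 ≤ n → ∀ i t j → Separated (leaf i (suc t)) (centre j)
  separated-outer-centre 5≤n i t j with i ≟ j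
  ... | yes refl = m∸n+o≤p⇒m≤n+∣o-p∣ 1 (outer+6≤centre 5≤n i t)
  ... | no _     = m∸n+o≤p⇒m≤n+∣o-p∣ 5 (≤-trans (s≤s (outer-label< i t)) (m≤m+n _ (3 * toℕ j)))

  separated-outer-inner : 5 ≤ n → ∀ i t j → Separated (leaf i (suc t)) (leaf j zero)
  separated-outer-inner 5≤n i t j with i ≟ j
  ... | yes refl = m∸n+o≤p⇒m≤n+∣o-p∣ 2 (outer+5≤inner 5≤n i t i)
  ... | no _     = m∸n+o≤p⇒m≤n+∣o-p∣ 4 (≤-trans (m≤n+m _ 2) (outer+5≤inner 5≤n i t j))

  separated-centre-inner : 5 ≤ n → ∀ i j → Separated (centre i) (leaf j zero)
  separated-centre-inner 5≤n i j with i ≟ j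
  ... | yes refl = m∸n+o≤p⇒m≤n+∣o-p∣ 1 (centre+6≤inner 5≤n i)
  ... | no _     = m∸n+o≤p⇒m≤n+∣o-p∣ 3 (centre+4≤inner i j)

  label-separated : 5 ≤ n → ∀ u v → u ≢ v → Separated u v
  label-separated 5≤n root v u≢v = separated-root v u≢v
  label-separated 5≤n u root u≢v = separated-sym root u (separated-root u (u≢v ∘ sym))
  label-separated 5≤n (centre i) (centre j) u≢v = separated-centres (u≢v ∘ cong centre)
  label-separated 5≤n (centre i) (leaf j zero) _ = separated-centre-inner 5≤n i j
  label-separated 5≤n (centre i) (leaf j (suc t)) _ =
    separated-sym (leaf j (suc t)) (centre i) (separated-outer-centre 5≤n j t i)
  label-separated 5≤n (leaf i zero) (centre j) _ =
    separated-sym (centre j) (leaf i zero) (separated-centre-inner 5≤n j i)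
  label-separated 5≤n (leaf i (suc s)) (centre j) _ = separated-outer-centre 5≤n i s j
  label-separated 5≤n (leaf i zero) (leaf j zero) u≢v = separated-inner (u≢v ∘ cong (λ i → leaf i zero))
  label-separated 5≤n (leaf i zero) (leaf j (suc t)) _ =
    separated-sym (leaf j (suc t)) (leaf i zero) (separated-outer-inner 5≤n j t i)
  label-separated 5≤n (leaf i (suc s)) (leaf j zero) _ = separated-outer-inner 5≤n i s j
  label-separated 5≤n (leaf i (suc s)) (leaf j (suc t)) u≢v =
    separated-outer 5≤n i j s t (λ { refl refl → u≢v refl })

  label-radio : 5 ≤ n → IsRadioLabeling Adj label
  label-radio 5≤n D diameter u v u≢v d (walk , _) = begin
    suc D                                 ≤⟨ s≤s (diameter≤6 diameter) ⟩
    7                                     ≤⟨ label-separated 5≤n u v u≢v ⟩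
    distance u v + ∣ label u - label v ∣  ≤⟨ +-monoˡ-≤ _ (distance≤length walk) ⟩
    d + ∣ label u - label v ∣             ∎

diameter-6 : ∀ {n c} → IsDiam (BAdj {2 + n} {3 + c}) 6
diameter-6 = (λ _ _ _ → dist≤6)
           , leaf zero (suc zero) , leaf (suc zero) (suc zero) , isDistance _ _

theorem4p1 : ∀ (n k : ℕ) → 5 ≤ n → 4 ≤ k →
    IsRadioNumber (BAdj {n} {k}) (n * (k + 6) + 1)
theorem4p1 (suc m) (suc (suc (suc c))) 5≤n@(s≤s (s≤s _)) (s≤s (s≤s (s≤s _))) =
    (label , label-radio 5≤n , label-span 5≤n (fromℕ m) (cong suc (toℕ-fromℕ m)))
  , λ f s radio span → radio-span≥ {f = f} (s≤s z≤n) diameter-6 radio span
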